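{- Fix $d\geq k\geq 1$. Forgetting the orientation gives a bijection from the set of $\alpha_{d,k}^-$-trees of charge $k$ onto the set $\mathcal{T}_k^{(d)}$ of well-charged trees of charge $k$ with all vertex degrees at most $d$. Similarly, forgetting the orientation gives a bijection from the set of $\alpha_{d,k}^+$-trees of charge $-k$ onto $\mathcal{T}_{ -k}^{(d)}$.
   Context: A blossoming tree is a plane tree rooted at a corner (root vertex $\rho$) whose vertices may carry opening stems (outgoing dangling half-edges) and closing stems (ingoing), counted in degrees; charge of the tree = #closing − #opening stems; charge of a vertex = charge of its subtree. A well-charged tree is a properly black/white colored blossoming tree where black vertices carry no closing stems and each non-root black vertex has charge $\le1$, and white vertices carry no opening stems and each non-root white vertex has charge $\ge 0$; $\mathcal{T}_j^{(d)}$ is the set of those with total charge $j$ and degrees at most $d$. A $(d+1)$-fractional orientation assigns values in $\mathbb{Z}_{\ge0}$ to half-edges with the two halves of each edge summing to $d+1$, $0$ on closing stems and $d+1$ on opening stems; outdegree = sum over incident half-edges; accessible = every vertex has a forward path (edges $(h_1,h_2)$ with $\mathcal{O}(h_1)>0$) to $\rho$. With $\alpha_d(v)=d\deg(v)$ (black), $\deg(v)$ (white), let $\alpha_{d,k}^\mp(v)=\alpha_d(v)\mp k\mathbf{1}_{\{v=\rho\}}$. An $\alpha_{d,k}^\mp$-tree is a properly black/white colored blossoming tree with degrees at most $d$ and an accessible $(d+1)$-fractional orientation with outdegrees $\alpha_{d,k}^\mp$; the trivial trees (a single black vertex with one closing stem, or a single white vertex with one opening stem) are excluded. -}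

module Defs where

open import Data.Nat using (ℕ; zero; suc; _+_; _*_; _≤_; _<_)
open import Data.Integer as ℤ using (ℤ; +_; -[1+_]) renaming (_+_ to _+ℤ_; _-_ to _-ℤ_; _≤_ to _≤ℤ_)
open import Data.List using (List; []; _∷_; length; _++_)
open import Data.Maybe using (Maybe; just; nothing)
open import Data.Bool using (Bool; true; false)
open import Data.Product using (Σ; _×_; _,_)
open import Data.Sum using (_⊎_)
open import Data.Unit using (⊤)
open import Data.Empty using (⊥)
open import Relation.Nullary using (¬_)
open import Relation.Binary.PropositionalEquality using (_≡_)
open import Relation.Binary.Construct.Closure.ReflexiveTransitive using (Star)

-- Blossoming plane trees rooted at a corner of the root vertex.
-- A vertex is the list of items met in counterclockwise order around it,
-- starting from the root corner (for the root) or just after the edge to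
-- the parent (for a non-root vertex).
-- Plain blossoming trees use E = ⊤; oriented ones use E = ℕ × ℕ, where
-- (a , b) are the values of the orientation on the half-edge at the parent
-- (a) and at the child (b).

mutual
  data Tree (E : Set) : Set where
    node : List (Item E) → Tree E

  data Item (E : Set) : Set where
    opening : Item E
    closing : Item E
    edge    : E → Tree E → Item E

-- Proper black/white colouring: given by the colour of the root, colours
-- alternate along edges.
data Color : Set where
  black white : Color

flipC : Color → Color
flipC black = white
flipC white = black

mutual
  forgetT : {E : Set} → Tree E → Tree ⊤
  forgetT (node is) = node (forgetL is)

  forgetL : {E : Set} → List (Item E) → List (Item ⊤)
  forgetL [] = []
  forgetL (opening ∷ is) = opening ∷ forgetL is
  forgetL (closing ∷ is) = closing ∷ forgetL is
  forgetL (edge _ t ∷ is) = edge _ (forgetT t) ∷ forgetL is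

-- Degrees: number of incident edges and stems (the parent edge counts for
-- a non-root vertex).  The Bool flag says whether the vertex is the root.

degree : {E : Set} → Bool → List (Item E) → ℕ
degree true  is = length is
degree false is = suc (length is)

mutual
  DegBounded : {E : Set} → ℕ → Bool → Tree E → Set
  DegBounded d r (node is) = degree r is ≤ d × DegBoundedL d is

  DegBoundedL : {E : Set} → ℕ → List (Item E) → Set
  DegBoundedL d [] = ⊤
  DegBoundedL d (opening ∷ is) = DegBoundedL d is
  DegBoundedL d (closing ∷ is) = DegBoundedL d is
  DegBoundedL d (edge _ t ∷ is) = DegBounded d false t × DegBoundedL d is

mutual
  charge : {E : Set} → Tree E → ℤ
  charge (node is) = chargeL is

  chargeL : {E : Set} → List (Item E) → ℤ
  chargeL [] = + 0
  chargeL (opening ∷ is) = -[1+ 0 ] +ℤ chargeL is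
  chargeL (closing ∷ is) = + 1 +ℤ chargeL is
  chargeL (edge _ t ∷ is) = charge t +ℤ chargeL is

StemOK : Color → Item ⊤ → Set
StemOK black closing = ⊥
StemOK white opening = ⊥
StemOK _ _ = ⊤

ChargeOK : Color → Bool → ℤ → Set
ChargeOK _     true  q = ⊤
ChargeOK black false q = q ≤ℤ + 1
ChargeOK white false q = + 0 ≤ℤ q

mutual
  WC : Color → Bool → Tree ⊤ → Set
  WC c r (node is) = ChargeOK c r (chargeL is) × WCL c is

  WCL : Color → List (Item ⊤) → Set
  WCL c [] = ⊤
  WCL c (edge _ t ∷ is) = WC (flipC c) false t × WCL c is
  WCL c (i ∷ is) = StemOK c i × WCL c is

WellCharged : ℕ → ℤ → Color → Tree ⊤ → Set
WellCharged d j c t = DegBounded d true t × WC c true t × charge t ≡ j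

Or : Set
Or = ℕ × ℕ

mutual
  Fractional : ℕ → Tree Or → Set
  Fractional d (node is) = FractionalL d is

  FractionalL : ℕ → List (Item Or) → Set
  FractionalL d [] = ⊤
  FractionalL d (opening ∷ is) = FractionalL d is
  FractionalL d (closing ∷ is) = FractionalL d is
  FractionalL d (edge (a , b) t ∷ is) = a + b ≡ suc d × Fractional d t × FractionalL d is

outL : ℕ → List (Item Or) → ℕ
outL d [] = 0
outL d (opening ∷ is) = suc d + outL d is
outL d (closing ∷ is) = outL d is
outL d (edge (a , b) _ ∷ is) = a + outL d is

-- parent: nothing for the root, just b (value of the half-edge of the parent
-- edge at this vertex) otherwise
isRoot : Maybe ℕ → Bool
isRoot nothing = true
isRoot (just _) = false

outdeg : ℕ → Maybe ℕ → List (Item Or) → ℕ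
outdeg d nothing  is = outL d is
outdeg d (just b) is = b + outL d is

alpha : ℕ → Color → ℕ → ℕ
alpha d black deg = d * deg
alpha d white deg = deg

data Sign : Set where
  minus plus : Sign

alphaDK : ℕ → ℕ → Sign → Color → Bool → ℕ → ℤ
alphaDK d k s     c false deg = + alpha d c deg
alphaDK d k minus c true  deg = + alpha d c deg -ℤ + k
alphaDK d k plus  c true  deg = + alpha d c deg +ℤ + k

mutual
  OutdegOK : ℕ → ℕ → Sign → Color → Maybe ℕ → Tree Or → Set
  OutdegOK d k s c par (node is) =
    + outdeg d par is ≡ alphaDK d k s c (isRoot par) (degree (isRoot par) is)
    × OutdegOKL d k s c is

  OutdegOKL : ℕ → ℕ → Sign → Color → List (Item Or) → Set
  OutdegOKL d k s c [] = ⊤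
  OutdegOKL d k s c (opening ∷ is) = OutdegOKL d k s c is
  OutdegOKL d k s c (closing ∷ is) = OutdegOKL d k s c is
  OutdegOKL d k s c (edge (a , b) t ∷ is) =
    OutdegOK d k s (flipC c) (just b) t × OutdegOKL d k s c is

-- Vertices as paths from the root (list of item indices), edges, and
-- forward paths.

nth : {A : Set} → List A → ℕ → Maybe A
nth [] _ = nothing
nth (x ∷ xs) zero = just x
nth (x ∷ xs) (suc n) = nth xs n

asEdge : {E : Set} → Maybe (Item E) → Maybe (E × Tree E)
asEdge (just (edge e t)) = just (e , t)
asEdge _ = nothing

childEdge : {E : Set} → Tree E → ℕ → Maybe (E × Tree E)
childEdge (node is) i = asEdge (nth is i)

mutual
  subtreeAt : {E : Set} → Tree E → List ℕ → Maybe (Tree E)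
  subtreeAt t [] = just t
  subtreeAt t (i ∷ p) = subtreeAtM (childEdge t i) p

  subtreeAtM : {E : Set} → Maybe (E × Tree E) → List ℕ → Maybe (Tree E)
  subtreeAtM nothing _ = nothing
  subtreeAtM (just (_ , s)) p = subtreeAt s p

edgeAt : {E : Set} → Tree E → List ℕ → ℕ → Maybe (E × Tree E)
edgeAt t p i = edgeAtM (subtreeAt t p) i
  where
  edgeAtM : {E : Set} → Maybe (Tree E) → ℕ → Maybe (E × Tree E)
  edgeAtM nothing _ = nothing
  edgeAtM (just s) i = childEdge s i

data Step (t : Tree Or) : List ℕ → List ℕ → Set where
  down : ∀ {p i a b s} → edgeAt t p i ≡ just ((a , b) , s) → 0 < a →
         Step t p (p ++ i ∷ [])
  up   : ∀ {p i a b s} → edgeAt t p i ≡ just ((a , b) , s) → 0 < b →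
         Step t (p ++ i ∷ []) p

Accessible : Tree Or → Set
Accessible t = ∀ p s → subtreeAt t p ≡ just s → Star (Step t) p []

Trivial : {E : Set} → Color → Tree E → Set
Trivial c t = (c ≡ black × t ≡ node (closing ∷ []))
            ⊎ (c ≡ white × t ≡ node (opening ∷ []))

AlphaTree : ℕ → ℕ → Sign → Color → Tree Or → Set
AlphaTree d k s c o =
  DegBounded d true o × Fractional d o × OutdegOK d k s c nothing o
  × Accessible o × ¬ Trivial c o

ForgetBijection : ℕ → ℕ → Sign → ℤ → Set
ForgetBijection d k s j =
  (∀ c (o : Tree Or) → AlphaTree d k s c o → charge o ≡ j →
     WellCharged d j c (forgetT o))
  × (∀ c (t : Tree ⊤) → WellCharged d j c t →
     Σ (Tree Or) λ o → forgetT o ≡ t × AlphaTree d k s c o × charge o ≡ j)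
  × (∀ c (o o′ : Tree Or) → AlphaTree d k s c o → charge o ≡ j →
     AlphaTree d k s c o′ → charge o′ ≡ j → forgetT o ≡ forgetT o′ → o ≡ o′)

-- Around a vertex of colour c whose child edges carry the canonical values, every item
-- contributes α_d(c)(1) to outdegree plus charge, except a misplaced stem (closing at black,
-- opening at white), which contributes α_d(c′)(1) for the other colour c′.  Hence at a non-root
-- vertex without misplaced stems, the outdegree condition says exactly that the child end of
-- its parent edge carries β = α_d(c)(1) + charge; this is the canonical value.  Misplaced stems
-- at non-root vertices are excluded by the degree bound d and 0 < b ≤ d + 1 (accessibility and
-- fractionality), and the same bounds on β are the charge conditions of well-charged trees.  At
-- the root, outdegree α_d(ρ) ∓ k together with charge ±k forces (d − 1)·#misplaced = 0, which
-- fails only for the trivial trees.  So an α-tree is the canonical orientation of its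
-- underlying tree, and the canonical orientation of a well-charged tree is an α-tree.
-- Accessibility amounts to positivity of every child end, since a path from a vertex to the
-- root must leave through its parent edge.

module Submission where

open import Defs
open import Data.Nat using (ℕ; zero; suc; _+_; _*_; _∸_; _≤_; _<_; s≤s; z≤n)
open import Data.Nat.Properties
  using (*-distribˡ-+; *-zeroʳ; *-identityʳ; *-identityˡ; *-suc; *-cancelʳ-≡; +-assoc; +-cancelʳ-≤;
         +-monoʳ-≤; +-mono-≤; m≤m*n; m≤n+m; m≤m+n; n≤1+n; <⇒≱; 0≢1+n;
         ≤-trans; ≤-refl; ≤-reflexive; m∸n+n≡m; m+n∸n≡m)
import Data.Nat.Properties as ℕ
import Data.Nat.Tactic.RingSolver as ℕ-Solver
open import Data.Integer as ℤ using (ℤ; +_; -_; -[1+_]; ∣_∣; +≤+)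
  renaming (_+_ to _+ℤ_; _-_ to _-ℤ_; _≤_ to _≤ℤ_)
import Data.Integer.Properties as ℤ
open import Data.Integer.Tactic.RingSolver using (solve-∀)
open import Algebra.Properties.AbelianGroup ℤ.+-0-abelianGroup
  using () renaming (∙-cancelʳ to +ℤ-cancelʳ; ∙-cancelˡ to +ℤ-cancelˡ)
open import Data.List using (List; []; _∷_; length; _++_; _∷ʳ_; initLast; _∷ʳ′_)
open import Data.List.Properties using (∷ʳ-injective; ++-assoc; ++-identityʳ)
open import Data.Maybe using (just; nothing)
open import Data.Bool using (true; false)
open import Data.Product using (Σ; ∃; _×_; _,_; proj₁; proj₂)
open import Data.Sum using (_⊎_; inj₁; inj₂)
open import Data.Unit using (⊤; tt)
open import Data.Empty using (⊥-elim)
open import Function using (id)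
open import Function.Bundles using (_⇔_; mk⇔; Equivalence)
open import Relation.Nullary using (¬_)
open import Relation.Binary.PropositionalEquality
open import Relation.Binary.Construct.Closure.ReflexiveTransitive using (Star; ε; _◅_; _◅◅_; gmap)

x+o≡z+y⇔x≡z+q : ∀ x o q z {y} → o +ℤ q ≡ y → (x +ℤ o ≡ z +ℤ y) ⇔ (x ≡ z +ℤ q)
x+o≡z+y⇔x≡z+q x o q z {y} o+q≡y =
  mk⇔ (λ h → +ℤ-cancelʳ o x (z +ℤ q) (trans h regroup))
      (λ h → trans (cong (_+ℤ o) h) (sym regroup))
  where
  regroup : z +ℤ y ≡ z +ℤ q +ℤ o
  regroup = trans (cong (z +ℤ_) (sym o+q≡y)) (shuffle z o q)
    where
    shuffle : ∀ z o q → z +ℤ (o +ℤ q) ≡ z +ℤ q +ℤ o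
    shuffle = solve-∀

x≡y-q⇔x+q≡y : ∀ x y q → (x ≡ y -ℤ q) ⇔ (x +ℤ q ≡ y)
x≡y-q⇔x+q≡y x y q =
  mk⇔ (λ h → trans (cong (_+ℤ q) h) (minus-plus y q))
      (λ h → trans (sym (plus-minus x q)) (cong (_-ℤ q) h))
  where
  minus-plus : ∀ y q → y -ℤ q +ℤ q ≡ y
  minus-plus = solve-∀
  plus-minus : ∀ x q → x +ℤ q -ℤ q ≡ x
  plus-minus = solve-∀

+ℤ-cancelˡ-≤ : ∀ x {y z} → x +ℤ y ≤ℤ x +ℤ z → y ≤ℤ z
+ℤ-cancelˡ-≤ x {y} {z} h = subst₂ _≤ℤ_ (neg-cancel x y) (neg-cancel x z) (ℤ.+-monoʳ-≤ (- x) h)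
  where
  neg-cancel : ∀ x y → - x +ℤ (x +ℤ y) ≡ y
  neg-cancel = solve-∀

m*n≡n⇒m≡1⊎n≡0 : ∀ m n → m * n ≡ n → m ≡ 1 ⊎ n ≡ 0
m*n≡n⇒m≡1⊎n≡0 m zero _ = inj₂ refl
m*n≡n⇒m≡1⊎n≡0 m (suc n) e = inj₁ (*-cancelʳ-≡ m 1 (suc n) (trans e (sym (*-identityˡ (suc n)))))

mutual
  charge-forget : ∀ {E} (t : Tree E) → charge (forgetT t) ≡ charge t
  charge-forget (node is) = chargeL-forget is

  chargeL-forget : ∀ {E} (is : List (Item E)) → chargeL (forgetL is) ≡ chargeL is
  chargeL-forget [] = refl
  chargeL-forget (opening ∷ is) = cong (-[1+ 0 ] +ℤ_) (chargeL-forget is)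
  chargeL-forget (closing ∷ is) = cong (+ 1 +ℤ_) (chargeL-forget is)
  chargeL-forget (edge _ t ∷ is) = cong₂ _+ℤ_ (charge-forget t) (chargeL-forget is)

length-forget : ∀ {E} (is : List (Item E)) → length (forgetL is) ≡ length is
length-forget [] = refl
length-forget (opening ∷ is) = cong suc (length-forget is)
length-forget (closing ∷ is) = cong suc (length-forget is)
length-forget (edge _ _ ∷ is) = cong suc (length-forget is)

degree-forget : ∀ {E} r (is : List (Item E)) → degree r (forgetL is) ≡ degree r is
degree-forget true is = length-forget is
degree-forget false is = cong suc (length-forget is)

mutual
  DegBounded-forget : ∀ {E} d r (t : Tree E) → DegBounded d r (forgetT t) ≡ DegBounded d r t
  DegBounded-forget d r (node is) =
    cong₂ _×_ (cong (_≤ d) (degree-forget r is)) (DegBoundedL-forget d is)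

  DegBoundedL-forget : ∀ {E} d (is : List (Item E)) → DegBoundedL d (forgetL is) ≡ DegBoundedL d is
  DegBoundedL-forget d [] = refl
  DegBoundedL-forget d (opening ∷ is) = DegBoundedL-forget d is
  DegBoundedL-forget d (closing ∷ is) = DegBoundedL-forget d is
  DegBoundedL-forget d (edge _ t ∷ is) =
    cong₂ _×_ (DegBounded-forget d false t) (DegBoundedL-forget d is)

misplacedItem : ∀ {E} → Color → Item E → ℕ
misplacedItem c (edge _ _) = 0
misplacedItem black opening = 0
misplacedItem white opening = 1
misplacedItem black closing = 1
misplacedItem white closing = 0

misplaced : ∀ {E} → Color → List (Item E) → ℕ
misplaced c [] = 0
misplaced c (i ∷ is) = misplacedItem c i + misplaced c is

misplaced-forget : ∀ {E} c (is : List (Item E)) → misplaced c (forgetL is) ≡ misplaced c is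
misplaced-forget c [] = refl
misplaced-forget black (opening ∷ is) = misplaced-forget black is
misplaced-forget white (opening ∷ is) = cong suc (misplaced-forget white is)
misplaced-forget black (closing ∷ is) = cong suc (misplaced-forget black is)
misplaced-forget white (closing ∷ is) = misplaced-forget white is
misplaced-forget c (edge _ _ ∷ is) = misplaced-forget c is

wellCharged⇒misplaced≡0 : ∀ c is → WCL c is → misplaced c is ≡ 0
wellCharged⇒misplaced≡0 c [] _ = refl
wellCharged⇒misplaced≡0 black (opening ∷ is) (_ , w) = wellCharged⇒misplaced≡0 black is w
wellCharged⇒misplaced≡0 black (closing ∷ is) (() , _)
wellCharged⇒misplaced≡0 white (opening ∷ is) (() , _)
wellCharged⇒misplaced≡0 white (closing ∷ is) (_ , w) = wellCharged⇒misplaced≡0 white is w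
wellCharged⇒misplaced≡0 c (edge _ _ ∷ is) (_ , w) = wellCharged⇒misplaced≡0 c is w

trivial⇒misplaced≡1 : ∀ {E} c (is : List (Item E)) → Trivial c (node is) → misplaced c is ≡ 1
trivial⇒misplaced≡1 black _ (inj₁ (refl , refl)) = refl
trivial⇒misplaced≡1 white _ (inj₂ (refl , refl)) = refl

misplaced-short⇒trivial : ∀ {E} c (is : List (Item E)) → length is ≤ 1 → 0 < misplaced c is →
  Trivial c (node is)
misplaced-short⇒trivial black (closing ∷ []) _ _ = inj₁ (refl , refl)
misplaced-short⇒trivial white (opening ∷ []) _ _ = inj₂ (refl , refl)
misplaced-short⇒trivial black (opening ∷ []) _ ()
misplaced-short⇒trivial white (closing ∷ []) _ ()
misplaced-short⇒trivial c (edge _ _ ∷ []) _ ()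
misplaced-short⇒trivial c (_ ∷ _ ∷ _) (s≤s ()) _

RootwardL : List (Item Or) → Set
RootwardL [] = ⊤
RootwardL (opening ∷ is) = RootwardL is
RootwardL (closing ∷ is) = RootwardL is
RootwardL (edge (_ , b) (node js) ∷ is) = 0 < b × RootwardL js × RootwardL is

rootward-child : ∀ is i {a b js} → RootwardL is → asEdge (nth is i) ≡ just ((a , b) , node js) →
  0 < b × RootwardL js
rootward-child [] i _ ()
rootward-child (opening ∷ is) zero _ ()
rootward-child (opening ∷ is) (suc i) r e = rootward-child is i r e
rootward-child (closing ∷ is) zero _ ()
rootward-child (closing ∷ is) (suc i) r e = rootward-child is i r e
rootward-child (edge _ (node _) ∷ is) zero (b>0 , r , _) refl = b>0 , r
rootward-child (edge _ (node _) ∷ is) (suc i) (_ , _ , r) e = rootward-child is i r e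

edgeAt-under : ∀ {E} (o : Tree E) i {e t} p j → childEdge o i ≡ just (e , t) →
  edgeAt o (i ∷ p) j ≡ edgeAt t p j
edgeAt-under o i p j ce rewrite ce = refl

step-under : ∀ (o : Tree Or) i {e t} → childEdge o i ≡ just (e , t) →
  ∀ {x y} → Step t x y → Step o (i ∷ x) (i ∷ y)
step-under o i ce (down {p} {j} e pos) = down (trans (edgeAt-under o i p j ce) e) pos
step-under o i ce (up {p} {j} e pos) = up (trans (edgeAt-under o i p j ce) e) pos

rootward⇒accessible : ∀ is → RootwardL is → Accessible (node is)
rootward⇒accessible is r [] s _ = ε
rootward⇒accessible is r (i ∷ p) s eq with asEdge (nth is i) in ce
rootward⇒accessible is r (i ∷ p) s () | nothing
rootward⇒accessible is r (i ∷ p) s eq | just ((a , b) , node js) =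
  gmap (i ∷_) (step-under (node is) i ce) (rootward⇒accessible js (proj₂ child) p s eq)
  ◅◅ up {p = []} ce (proj₁ child) ◅ ε
  where
  child : 0 < b × RootwardL js
  child = rootward-child is i r ce

_≼_ : List ℕ → List ℕ → Set
p ≼ x = ∃ λ r → x ≡ p ++ r

[]⋡∷ʳ : ∀ q {i} → ¬ (q ∷ʳ i) ≼ []
[]⋡∷ʳ [] (_ , ())
[]⋡∷ʳ (_ ∷ _) (_ , ())

leaving-crosses-edge : ∀ (o : Tree Or) q i {a b s x y} → edgeAt o q i ≡ just ((a , b) , s) →
  Star (Step o) x y → (q ∷ʳ i) ≼ x → ¬ (q ∷ʳ i) ≼ y → 0 < b
leaving-crosses-edge o q i e ε x≽ y⋡ = ⊥-elim (y⋡ x≽)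
leaving-crosses-edge o q i e (down {p} {j} _ _ ◅ path) (r , refl) y⋡ =
  leaving-crosses-edge o q i e path (r ∷ʳ j , ++-assoc (q ∷ʳ i) r (j ∷ [])) y⋡
leaving-crosses-edge o q i e (up {p} {j} e′ pos ◅ path) (r , eq) y⋡ with initLast r
... | [] with ∷ʳ-injective p q (trans eq (++-identityʳ (q ∷ʳ i)))
...   | refl , refl with trans (sym e) e′
...     | refl = pos
leaving-crosses-edge o q i e (up {p} {j} e′ pos ◅ path) (r , eq) y⋡ | r₀ ∷ʳ′ z =
  leaving-crosses-edge o q i e path (r₀ , proj₁ (∷ʳ-injective p ((q ∷ʳ i) ++ r₀) eq′)) y⋡
  where
  eq′ : p ∷ʳ j ≡ ((q ∷ʳ i) ++ r₀) ∷ʳ z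
  eq′ = trans eq (sym (++-assoc (q ∷ʳ i) r₀ (z ∷ [])))

edgeAt⇒subtreeAt : ∀ {E} (o : Tree E) q i {e s} → edgeAt o q i ≡ just (e , s) →
  subtreeAt o (q ∷ʳ i) ≡ just s
edgeAt⇒subtreeAt o [] i h with childEdge o i
edgeAt⇒subtreeAt o [] i refl | just _ = refl
edgeAt⇒subtreeAt o (j ∷ q) i h with childEdge o j
edgeAt⇒subtreeAt o (j ∷ q) i () | nothing
edgeAt⇒subtreeAt o (j ∷ q) i h | just (_ , t) = edgeAt⇒subtreeAt t q i h

ChildSidesPositive : Tree Or → Set
ChildSidesPositive o = ∀ q i {a b s} → edgeAt o q i ≡ just ((a , b) , s) → 0 < b

accessible⇒childSidesPositive : ∀ o → Accessible o → ChildSidesPositive o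
accessible⇒childSidesPositive o acc q i e =
  leaving-crosses-edge o q i e (acc (q ∷ʳ i) _ (edgeAt⇒subtreeAt o q i e))
    ([] , sym (++-identityʳ (q ∷ʳ i))) ([]⋡∷ʳ q)

childSidesPositive-∷ : ∀ {x is} → ChildSidesPositive (node (x ∷ is)) → ChildSidesPositive (node is)
childSidesPositive-∷ h [] i e = h [] (suc i) e
childSidesPositive-∷ h (j ∷ q) i e = h (suc j ∷ q) i e

childSidesPositive⇒rootward : ∀ is → ChildSidesPositive (node is) → RootwardL is
childSidesPositive⇒rootward [] _ = tt
childSidesPositive⇒rootward (opening ∷ is) h = childSidesPositive⇒rootward is (childSidesPositive-∷ h)
childSidesPositive⇒rootward (closing ∷ is) h = childSidesPositive⇒rootward is (childSidesPositive-∷ h)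
childSidesPositive⇒rootward (edge _ (node js) ∷ is) h =
  h [] zero refl ,
  childSidesPositive⇒rootward js (λ q i → h (zero ∷ q) i) ,
  childSidesPositive⇒rootward is (childSidesPositive-∷ h)

accessible⇒rootward : ∀ is → Accessible (node is) → RootwardL is
accessible⇒rootward is acc = childSidesPositive⇒rootward is (accessible⇒childSidesPositive (node is) acc)

alpha-+ : ∀ d c m n → alpha d c (m + n) ≡ alpha d c m + alpha d c n
alpha-+ d black m n = *-distribˡ-+ d m n
alpha-+ d white m n = refl

alpha-0 : ∀ d c → alpha d c 0 ≡ 0
alpha-0 d black = *-zeroʳ d
alpha-0 d white = refl

alpha-1-flip : ∀ d c → alpha d c 1 + alpha d (flipC c) 1 ≡ suc d
alpha-1-flip d black = trans (cong (_+ 1) (*-identityʳ d)) (ℕ.+-comm d 1)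
alpha-1-flip d white = cong suc (*-identityʳ d)

β : ℕ → Color → ℤ → ℤ
β d c q = + alpha d c 1 +ℤ q

-- β is positive on the subtrees of well-charged trees (β-bounds), so ∣_∣ loses nothing.
childValue : ℕ → Color → Tree ⊤ → ℕ
childValue d c t = ∣ β d c (charge t) ∣

mutual
  build : ℕ → Color → Tree ⊤ → Tree Or
  build d c (node is) = node (buildL d c is)

  buildL : ℕ → Color → List (Item ⊤) → List (Item Or)
  buildL d c [] = []
  buildL d c (opening ∷ is) = opening ∷ buildL d c is
  buildL d c (closing ∷ is) = closing ∷ buildL d c is
  buildL d c (edge _ t ∷ is) =
    edge (suc d ∸ childValue d (flipC c) t , childValue d (flipC c) t) (build d (flipC c) t)
    ∷ buildL d c is

mutual
  forget-build : ∀ d c t → forgetT (build d c t) ≡ t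
  forget-build d c (node is) = cong node (forgetL-buildL d c is)

  forgetL-buildL : ∀ d c is → forgetL (buildL d c is) ≡ is
  forgetL-buildL d c [] = refl
  forgetL-buildL d c (opening ∷ is) = cong (opening ∷_) (forgetL-buildL d c is)
  forgetL-buildL d c (closing ∷ is) = cong (closing ∷_) (forgetL-buildL d c is)
  forgetL-buildL d c (edge _ t ∷ is) =
    cong₂ _∷_ (cong (edge _) (forget-build d (flipC c) t)) (forgetL-buildL d c is)

chargeL-buildL : ∀ d c is → chargeL (buildL d c is) ≡ chargeL is
chargeL-buildL d c is = trans (sym (chargeL-forget (buildL d c is))) (cong chargeL (forgetL-buildL d c is))

misplaced-buildL : ∀ d c c′ is → misplaced c′ (buildL d c is) ≡ misplaced c′ is
misplaced-buildL d c c′ is =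
  trans (sym (misplaced-forget c′ (buildL d c is))) (cong (misplaced c′) (forgetL-buildL d c is))

mutual
  CanonicalL : ℕ → Color → List (Item Or) → Set
  CanonicalL d c [] = ⊤
  CanonicalL d c (opening ∷ is) = CanonicalL d c is
  CanonicalL d c (closing ∷ is) = CanonicalL d c is
  CanonicalL d c (edge (a , b) t ∷ is) = CanonicalEdge d (flipC c) a b t × CanonicalL d c is

  CanonicalEdge : ℕ → Color → ℕ → ℕ → Tree Or → Set
  CanonicalEdge d c a b (node js) =
    a + b ≡ suc d × 0 < b × + b ≡ β d c (chargeL js) × misplaced c js ≡ 0 × CanonicalL d c js

canonical⇒fractional : ∀ d c is → CanonicalL d c is → FractionalL d is
canonical⇒fractional d c [] _ = tt
canonical⇒fractional d c (opening ∷ is) h = canonical⇒fractional d c is h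
canonical⇒fractional d c (closing ∷ is) h = canonical⇒fractional d c is h
canonical⇒fractional d c (edge _ (node js) ∷ is) ((ab , _ , _ , _ , hjs) , h) =
  ab , canonical⇒fractional d (flipC c) js hjs , canonical⇒fractional d c is h

canonical⇒build : ∀ d c is → CanonicalL d c is → is ≡ buildL d c (forgetL is)
canonical⇒build d c [] _ = refl
canonical⇒build d c (opening ∷ is) h = cong (opening ∷_) (canonical⇒build d c is h)
canonical⇒build d c (closing ∷ is) h = cong (closing ∷_) (canonical⇒build d c is h)
canonical⇒build d c (edge (a , b) (node js) ∷ is) ((ab , _ , b≡β , _ , hjs) , h) =
  cong₂ _∷_ (cong₂ edge (cong₂ _,_ (trans a≡ (cong (suc d ∸_) b≡)) b≡)
                        (cong node (canonical⇒build d (flipC c) js hjs)))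
            (canonical⇒build d c is h)
  where
  b≡ : b ≡ childValue d (flipC c) (node (forgetL js))
  b≡ = cong ∣_∣ (trans b≡β (cong (β d (flipC c)) (sym (chargeL-forget js))))
  a≡ : a ≡ suc d ∸ b
  a≡ = trans (sym (m+n∸n≡m a b)) (cong (_∸ b) ab)

outItem : ℕ → Item Or → ℕ
outItem d opening = suc d
outItem d closing = 0
outItem d (edge (a , _) _) = a

chargeItem : Item Or → ℤ
chargeItem opening = -[1+ 0 ]
chargeItem closing = + 1
chargeItem (edge _ t) = charge t

outL-∷ : ∀ d i is → outL d (i ∷ is) ≡ outItem d i + outL d is
outL-∷ d opening is = refl
outL-∷ d closing is = refl
outL-∷ d (edge _ _) is = refl

chargeL-∷ : ∀ i is → chargeL (i ∷ is) ≡ chargeItem i +ℤ chargeL is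
chargeL-∷ opening is = refl
chargeL-∷ closing is = refl
chargeL-∷ (edge _ _) is = refl

ItemBalance : ℕ → Color → Item Or → Set
ItemBalance d c i =
  + outItem d i +ℤ chargeItem i +ℤ + alpha d c (misplacedItem c i)
  ≡ + alpha d c 1 +ℤ + alpha d (flipC c) (misplacedItem c i)

Balance : ℕ → Color → List (Item Or) → Set
Balance d c is =
  + outL d is +ℤ chargeL is +ℤ + alpha d c (misplaced c is)
  ≡ + alpha d c (length is) +ℤ + alpha d (flipC c) (misplaced c is)

opening-balance : ∀ d c → ItemBalance d c opening
opening-balance d black rewrite *-zeroʳ d | *-identityʳ d = refl
opening-balance d white rewrite *-identityʳ d = cong +_ (ℕ.+-comm d 1)

closing-balance : ∀ d c → ItemBalance d c closing
closing-balance d black rewrite *-identityʳ d = cong +_ (ℕ.+-comm 1 d)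
closing-balance d white rewrite *-zeroʳ d = refl

edge-balance : ∀ d c {a b t} → a + b ≡ suc d → + b ≡ β d (flipC c) (charge t) →
  ItemBalance d c (edge (a , b) t)
edge-balance d c {a} {b} {t} ab b≡β =
  cong₂ _+ℤ_ out+charge (cong +_ (trans (alpha-0 d c) (sym (alpha-0 d (flipC c)))))
  where
  f : ℕ
  f = alpha d (flipC c) 1
  out+charge : + a +ℤ charge t ≡ + alpha d c 1
  out+charge = +ℤ-cancelʳ (+ f) _ _ (begin
    + a +ℤ charge t +ℤ + f     ≡⟨ shuffle (+ a) (charge t) (+ f) ⟩
    + a +ℤ (+ f +ℤ charge t)   ≡⟨ cong (+ a +ℤ_) (sym b≡β) ⟩
    + (a + b)                  ≡⟨ cong +_ (trans ab (sym (alpha-1-flip d c))) ⟩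
    + alpha d c 1 +ℤ + f       ∎)
    where
    open ≡-Reasoning
    shuffle : ∀ x q y → x +ℤ q +ℤ y ≡ x +ℤ (y +ℤ q)
    shuffle = solve-∀

balance-∷ : ∀ d c i is → ItemBalance d c i → Balance d c is → Balance d c (i ∷ is)
balance-∷ d c i is hi his = begin
  + outL d (i ∷ is) +ℤ chargeL (i ∷ is) +ℤ + A (mᵢ + m)
    ≡⟨ cong₂ (λ o q → + o +ℤ q +ℤ + A (mᵢ + m)) (outL-∷ d i is) (chargeL-∷ i is) ⟩
  + (oᵢ + o) +ℤ (qᵢ +ℤ q) +ℤ + A (mᵢ + m)
    ≡⟨ cong (λ n → + (oᵢ + o) +ℤ (qᵢ +ℤ q) +ℤ + n) (alpha-+ d c mᵢ m) ⟩
  + (oᵢ + o) +ℤ (qᵢ +ℤ q) +ℤ + (A mᵢ + A m)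
    ≡⟨ regroup (+ oᵢ) qᵢ (+ A mᵢ) (+ o) q (+ A m) ⟩
  (+ oᵢ +ℤ qᵢ +ℤ + A mᵢ) +ℤ (+ o +ℤ q +ℤ + A m)
    ≡⟨ cong₂ _+ℤ_ hi his ⟩
  (+ A 1 +ℤ + F mᵢ) +ℤ (+ A (length is) +ℤ + F m)
    ≡⟨ interchange (+ A 1) (+ F mᵢ) (+ A (length is)) (+ F m) ⟩
  + (A 1 + A (length is)) +ℤ + (F mᵢ + F m)
    ≡⟨ sym (cong₂ (λ x y → + x +ℤ + y) (alpha-+ d c 1 (length is)) (alpha-+ d (flipC c) mᵢ m)) ⟩
  + A (length (i ∷ is)) +ℤ + F (mᵢ + m) ∎
  where
  open ≡-Reasoning
  A F : ℕ → ℕ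
  A = alpha d c
  F = alpha d (flipC c)
  oᵢ o mᵢ m : ℕ
  oᵢ = outItem d i
  o = outL d is
  mᵢ = misplacedItem c i
  m = misplaced c is
  qᵢ q : ℤ
  qᵢ = chargeItem i
  q = chargeL is
  regroup : ∀ x q y x′ q′ y′ →
    (x +ℤ x′) +ℤ (q +ℤ q′) +ℤ (y +ℤ y′) ≡ (x +ℤ q +ℤ y) +ℤ (x′ +ℤ q′ +ℤ y′)
  regroup = solve-∀
  interchange : ∀ x y x′ y′ → (x +ℤ y) +ℤ (x′ +ℤ y′) ≡ (x +ℤ x′) +ℤ (y +ℤ y′)
  interchange = solve-∀

balance : ∀ d c is → CanonicalL d c is → Balance d c is
balance d c [] _ =
  cong +_ (sym (trans (cong (_+_ (alpha d c 0)) (alpha-0 d (flipC c))) (ℕ.+-identityʳ _)))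
balance d c (opening ∷ is) h = balance-∷ d c opening is (opening-balance d c) (balance d c is h)
balance d c (closing ∷ is) h = balance-∷ d c closing is (closing-balance d c) (balance d c is h)
balance d c (edge (a , b) (node js) ∷ is) ((ab , _ , b≡β , _ , _) , h) =
  balance-∷ d c (edge (a , b) (node js)) is (edge-balance d c {t = node js} ab b≡β) (balance d c is h)

balance₀ : ∀ d c is → CanonicalL d c is → misplaced c is ≡ 0 →
  + outL d is +ℤ chargeL is ≡ + alpha d c (length is)
balance₀ d c is h m≡0 = +ℤ-cancelʳ (+ 0) _ _ (begin
  + outL d is +ℤ chargeL is +ℤ + 0
    ≡⟨ cong (λ n → + outL d is +ℤ chargeL is +ℤ + n) (sym (no-misplaced c)) ⟩
  + outL d is +ℤ chargeL is +ℤ + alpha d c (misplaced c is)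
    ≡⟨ balance d c is h ⟩
  + alpha d c (length is) +ℤ + alpha d (flipC c) (misplaced c is)
    ≡⟨ cong (λ n → + alpha d c (length is) +ℤ + n) (no-misplaced (flipC c)) ⟩
  + alpha d c (length is) +ℤ + 0 ∎)
  where
  open ≡-Reasoning
  no-misplaced : ∀ c′ → alpha d c′ (misplaced c is) ≡ 0
  no-misplaced c′ = trans (cong (alpha d c′) m≡0) (alpha-0 d c′)

outL-upper : ∀ d c is → CanonicalL d c is → outL d is + suc d * misplaced black is ≤ suc d * length is
outL-upper d c [] _ = ≤-refl
outL-upper d c (opening ∷ is) h = begin
  suc d + outL d is + suc d * misplaced black is   ≡⟨ +-assoc (suc d) _ _ ⟩
  suc d + (outL d is + suc d * misplaced black is) ≤⟨ +-monoʳ-≤ (suc d) (outL-upper d c is h) ⟩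
  suc d + suc d * length is                        ≡⟨ sym (*-suc (suc d) (length is)) ⟩
  suc d * suc (length is)                          ∎
  where open ℕ.≤-Reasoning
outL-upper d c (closing ∷ is) h = begin
  outL d is + suc d * suc (misplaced black is)     ≡⟨ shuffle (outL d is) (suc d) (misplaced black is) ⟩
  suc d + (outL d is + suc d * misplaced black is) ≤⟨ +-monoʳ-≤ (suc d) (outL-upper d c is h) ⟩
  suc d + suc d * length is                        ≡⟨ sym (*-suc (suc d) (length is)) ⟩
  suc d * suc (length is)                          ∎
  where
  open ℕ.≤-Reasoning
  shuffle : ∀ o e m → o + e * suc m ≡ e + (o + e * m)
  shuffle = ℕ-Solver.solve-∀
outL-upper d c (edge (a , b) (node js) ∷ is) ((ab , _) , h) = begin
  a + outL d is + suc d * misplaced black is   ≡⟨ +-assoc a _ _ ⟩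
  a + (outL d is + suc d * misplaced black is) ≤⟨ +-mono-≤ a≤ (outL-upper d c is h) ⟩
  suc d + suc d * length is                    ≡⟨ sym (*-suc (suc d) (length is)) ⟩
  suc d * suc (length is)                      ∎
  where
  open ℕ.≤-Reasoning
  a≤ : a ≤ suc d
  a≤ = subst (a ≤_) ab (m≤m+n a b)

outL-lower : ∀ d is → suc d * misplaced white is ≤ outL d is
outL-lower d [] = ≤-reflexive (*-zeroʳ d)
outL-lower d (opening ∷ is) = begin
  suc d * suc (misplaced white is)  ≡⟨ *-suc (suc d) _ ⟩
  suc d + suc d * misplaced white is ≤⟨ +-monoʳ-≤ (suc d) (outL-lower d is) ⟩
  suc d + outL d is                 ∎
  where open ℕ.≤-Reasoning
outL-lower d (closing ∷ is) = outL-lower d is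
outL-lower d (edge (a , _) _ ∷ is) = ≤-trans (outL-lower d is) (m≤n+m _ a)

nonroot-misplaced≡0 : ∀ d c b is → CanonicalL d c is → b ≤ suc d → suc (length is) ≤ d →
  b + outL d is ≡ alpha d c (suc (length is)) → misplaced c is ≡ 0
nonroot-misplaced≡0 d black b is h b≤ deg out-eq with misplaced black is in m≡
... | zero = refl
-- a closing stem carries no outdegree, which would force d (L + 1) ≤ (d + 1) L
... | suc m = ⊥-elim (<⇒≱ deg (+-cancelʳ-≤ (d * L + suc d) d L chain))
  where
  open ℕ.≤-Reasoning
  L o : ℕ
  L = length is
  o = outL d is
  lhs : ∀ d L → d + (d * L + suc d) ≡ d * suc L + suc d
  lhs = ℕ-Solver.solve-∀
  rhs : ∀ d L → suc d + suc d * L ≡ L + (d * L + suc d)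
  rhs = ℕ-Solver.solve-∀
  upper : o + suc d * suc m ≤ suc d * L
  upper = subst (λ n → o + suc d * n ≤ suc d * L) m≡ (outL-upper d black is h)
  chain : d + (d * L + suc d) ≤ L + (d * L + suc d)
  chain = begin
    d + (d * L + suc d)         ≡⟨ lhs d L ⟩
    d * suc L + suc d           ≡⟨ cong (_+ suc d) (sym out-eq) ⟩
    b + o + suc d               ≤⟨ +-monoʳ-≤ (b + o) (m≤m*n (suc d) (suc m)) ⟩
    b + o + suc d * suc m       ≡⟨ +-assoc b o _ ⟩
    b + (o + suc d * suc m)     ≤⟨ +-mono-≤ b≤ upper ⟩
    suc d + suc d * L           ≡⟨ rhs d L ⟩
    L + (d * L + suc d)         ∎
nonroot-misplaced≡0 d white b is h b≤ deg out-eq with misplaced white is in m≡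
... | zero = refl
-- an opening stem alone carries outdegree d + 1 > L + 1
... | suc m = ⊥-elim (<⇒≱ deg (ℕ.≤-pred (begin
    suc d                   ≤⟨ m≤m*n (suc d) (suc m) ⟩
    suc d * suc m           ≤⟨ subst (λ n → suc d * n ≤ outL d is) m≡ (outL-lower d is) ⟩
    outL d is               ≤⟨ m≤n+m _ b ⟩
    b + outL d is           ≡⟨ out-eq ⟩
    suc (length is)         ∎)))
  where open ℕ.≤-Reasoning

nonroot-outdeg⇔β : ∀ d c b is → CanonicalL d c is → misplaced c is ≡ 0 →
  (+ (b + outL d is) ≡ + alpha d c (suc (length is))) ⇔ (+ b ≡ β d c (chargeL is))
nonroot-outdeg⇔β d c b is h m≡0 =
  subst (λ n → (+ (b + outL d is) ≡ + n) ⇔ (+ b ≡ β d c (chargeL is)))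
        (sym (alpha-+ d c 1 (length is)))
        (x+o≡z+y⇔x≡z+q (+ b) (+ outL d is) (chargeL is) (+ alpha d c 1) (balance₀ d c is h m≡0))

alpha-flip⇒d*n≡n : ∀ d c n → alpha d c n ≡ alpha d (flipC c) n → d * n ≡ n
alpha-flip⇒d*n≡n d black n e = e
alpha-flip⇒d*n≡n d white n e = sym e

root-alpha-flip : ∀ d c is → CanonicalL d c is →
  + outL d is ≡ + alpha d c (length is) -ℤ chargeL is →
  alpha d c (misplaced c is) ≡ alpha d (flipC c) (misplaced c is)
root-alpha-flip d c is h out-eq = ℤ.+-injective (+ℤ-cancelˡ (+ outL d is +ℤ chargeL is) _ _
  (trans (balance d c is h) (cong (_+ℤ + alpha d (flipC c) (misplaced c is)) (sym out+q≡α))))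
  where
  out+q≡α : + outL d is +ℤ chargeL is ≡ + alpha d c (length is)
  out+q≡α = Equivalence.to (x≡y-q⇔x+q≡y (+ outL d is) (+ alpha d c (length is)) (chargeL is)) out-eq

root-misplaced≡0 : ∀ d c is → CanonicalL d c is → length is ≤ d →
  + outL d is ≡ + alpha d c (length is) -ℤ chargeL is → ¬ Trivial c (node is) → misplaced c is ≡ 0
root-misplaced≡0 d c is h deg out-eq nontrivial
  with m*n≡n⇒m≡1⊎n≡0 d (misplaced c is) (alpha-flip⇒d*n≡n d c _ (root-alpha-flip d c is h out-eq))
... | inj₂ m≡0 = m≡0
... | inj₁ refl with misplaced c is in m≡
...   | zero = refl
...   | suc _ = ⊥-elim (nontrivial (misplaced-short⇒trivial c is deg (subst (0 <_) (sym m≡) (s≤s z≤n))))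

alphaConditions⇒canonical : ∀ d k s c is → DegBoundedL d is → FractionalL d is →
  OutdegOKL d k s c is → RootwardL is → CanonicalL d c is
alphaConditions⇒canonical d k s c [] _ _ _ _ = tt
alphaConditions⇒canonical d k s c (opening ∷ is) = alphaConditions⇒canonical d k s c is
alphaConditions⇒canonical d k s c (closing ∷ is) = alphaConditions⇒canonical d k s c is
alphaConditions⇒canonical d k s c (edge (a , b) (node js) ∷ is)
  ((deg , degs) , degs′) (ab , fr , fr′) ((out-eq , od) , od′) (b>0 , r , r′) =
  (ab , b>0 , Equivalence.to (nonroot-outdeg⇔β d c′ b js canonical m≡0) out-eq , m≡0 , canonical) ,
  alphaConditions⇒canonical d k s c is degs′ fr′ od′ r′
  where
  c′ : Color
  c′ = flipC c
  canonical : CanonicalL d c′ js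
  canonical = alphaConditions⇒canonical d k s c′ js degs fr od r
  m≡0 : misplaced c′ js ≡ 0
  m≡0 = nonroot-misplaced≡0 d c′ b js canonical (subst (b ≤_) ab (m≤n+m b a)) deg
          (ℤ.+-injective out-eq)

canonical⇒outdegOK : ∀ d k s c is → CanonicalL d c is → OutdegOKL d k s c is
canonical⇒outdegOK d k s c [] _ = tt
canonical⇒outdegOK d k s c (opening ∷ is) = canonical⇒outdegOK d k s c is
canonical⇒outdegOK d k s c (closing ∷ is) = canonical⇒outdegOK d k s c is
canonical⇒outdegOK d k s c (edge (a , b) (node js) ∷ is) ((_ , _ , b≡β , m≡0 , h) , h′) =
  (Equivalence.from (nonroot-outdeg⇔β d (flipC c) b js h m≡0) b≡β ,
   canonical⇒outdegOK d k s (flipC c) js h) ,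
  canonical⇒outdegOK d k s c is h′

canonical⇒rootward : ∀ d c is → CanonicalL d c is → RootwardL is
canonical⇒rootward d c [] _ = tt
canonical⇒rootward d c (opening ∷ is) = canonical⇒rootward d c is
canonical⇒rootward d c (closing ∷ is) = canonical⇒rootward d c is
canonical⇒rootward d c (edge _ (node js) ∷ is) ((_ , b>0 , _ , _ , h) , h′) =
  b>0 , canonical⇒rootward d (flipC c) js h , canonical⇒rootward d c is h′

β⇒chargeOK : ∀ d c {a b q} → a + b ≡ suc d → 0 < b → + b ≡ β d c q → ChargeOK c false q
β⇒chargeOK d black {a} {b} ab _ b≡β =
  +ℤ-cancelˡ-≤ (+ alpha d black 1) (subst (_≤ℤ + (alpha d black 1 + 1)) b≡β (+≤+ b≤))
  where
  b≤ : b ≤ alpha d black 1 + 1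
  b≤ = subst (b ≤_) (trans ab (sym (alpha-1-flip d black))) (m≤n+m b a)
β⇒chargeOK d white _ b>0 b≡β = +ℤ-cancelˡ-≤ (+ 1) (subst (+ 1 ≤ℤ_) b≡β (+≤+ b>0))

canonical⇒wellCharged : ∀ d c is → CanonicalL d c is → misplaced c is ≡ 0 → WCL c (forgetL is)
canonical⇒wellCharged d c [] _ _ = tt
canonical⇒wellCharged d black (opening ∷ is) h m≡0 = tt , canonical⇒wellCharged d black is h m≡0
canonical⇒wellCharged d white (closing ∷ is) h m≡0 = tt , canonical⇒wellCharged d white is h m≡0
canonical⇒wellCharged d black (closing ∷ is) _ ()
canonical⇒wellCharged d white (opening ∷ is) _ ()
canonical⇒wellCharged d c (edge (a , b) (node js) ∷ is) ((ab , b>0 , b≡β , m≡0 , h) , h′) m≡0′ =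
  (subst (ChargeOK (flipC c) false) (sym (chargeL-forget js)) (β⇒chargeOK d (flipC c) ab b>0 b≡β) ,
   canonical⇒wellCharged d (flipC c) js h m≡0) ,
  canonical⇒wellCharged d c is h′ m≡0′

chargeL-black-lower : ∀ is → WCL black is → - + length is ≤ℤ chargeL is
chargeL-black-lower [] _ = ℤ.≤-refl
chargeL-black-lower (opening ∷ is) (_ , w) =
  subst (_≤ℤ -[1+ 0 ] +ℤ chargeL is) (neg-suc (+ length is))
    (ℤ.+-monoʳ-≤ -[1+ 0 ] (chargeL-black-lower is w))
  where
  neg-suc : ∀ n → - + 1 +ℤ - n ≡ - (+ 1 +ℤ n)
  neg-suc = solve-∀
chargeL-black-lower (closing ∷ is) (() , _)
chargeL-black-lower (edge _ (node js) ∷ is) ((0≤q , _) , w) =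
  ℤ.≤-trans (ℤ.neg-mono-≤ (+≤+ (n≤1+n (length is))))
    (subst (_≤ℤ chargeL js +ℤ chargeL is) (ℤ.+-identityˡ (- + length is))
      (ℤ.+-mono-≤ 0≤q (chargeL-black-lower is w)))

chargeL-white-upper : ∀ is → WCL white is → chargeL is ≤ℤ + length is
chargeL-white-upper [] _ = ℤ.≤-refl
chargeL-white-upper (opening ∷ is) (() , _)
chargeL-white-upper (closing ∷ is) (_ , w) = ℤ.+-monoʳ-≤ (+ 1) (chargeL-white-upper is w)
chargeL-white-upper (edge _ (node js) ∷ is) ((q≤1 , _) , w) = ℤ.+-mono-≤ q≤1 (chargeL-white-upper is w)

β-bounds : ∀ d c js → WC c false (node js) → suc (length js) ≤ d →
  + 1 ≤ℤ β d c (chargeL js) × β d c (chargeL js) ≤ℤ + suc d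
β-bounds d black js (q≤1 , w) deg = lower , upper
  where
  open ℤ.≤-Reasoning
  L : ℕ
  L = length js
  lower : + 1 ≤ℤ β d black (chargeL js)
  lower = begin
    + 1                            ≡⟨ one (+ L) ⟩
    + suc L +ℤ - + L               ≤⟨ ℤ.+-monoˡ-≤ (- + L) (+≤+ deg′) ⟩
    + alpha d black 1 +ℤ - + L     ≤⟨ ℤ.+-monoʳ-≤ (+ alpha d black 1) (chargeL-black-lower js w) ⟩
    β d black (chargeL js)         ∎
    where
    one : ∀ n → + 1 ≡ + 1 +ℤ n +ℤ - n
    one = solve-∀
    deg′ : suc L ≤ alpha d black 1
    deg′ = subst (suc L ≤_) (sym (*-identityʳ d)) deg
  upper : β d black (chargeL js) ≤ℤ + suc d
  upper = begin
    β d black (chargeL js)            ≤⟨ ℤ.+-monoʳ-≤ (+ alpha d black 1) q≤1 ⟩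
    + (alpha d black 1 + 1)           ≡⟨ cong +_ (alpha-1-flip d black) ⟩
    + suc d                           ∎
β-bounds d white js (0≤q , w) deg =
  ℤ.+-monoʳ-≤ (+ 1) 0≤q ,
  ℤ.≤-trans (ℤ.+-monoʳ-≤ (+ 1) (chargeL-white-upper js w)) (+≤+ (≤-trans deg (n≤1+n d)))

buildL-canonical : ∀ d c is → WCL c is → DegBoundedL d is → CanonicalL d c (buildL d c is)
buildL-canonical d c [] _ _ = tt
buildL-canonical d black (opening ∷ is) (_ , w) deg = buildL-canonical d black is w deg
buildL-canonical d white (closing ∷ is) (_ , w) deg = buildL-canonical d white is w deg
buildL-canonical d black (closing ∷ is) (() , _)
buildL-canonical d white (opening ∷ is) (() , _)
buildL-canonical d c (edge _ (node js) ∷ is) (wc@(_ , wjs) , w) ((deg , degs) , degs′) =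
  (m∸n+n≡m v≤ , ℤ.drop‿+≤+ (subst (+ 1 ≤ℤ_) (sym v≡β) lower) ,
   trans v≡β (cong (β d c′) (sym (chargeL-buildL d c′ js))) ,
   trans (misplaced-buildL d c′ c′ js) (wellCharged⇒misplaced≡0 c′ js wjs) ,
   buildL-canonical d c′ js wjs degs) ,
  buildL-canonical d c is w degs′
  where
  c′ : Color
  c′ = flipC c
  q : ℤ
  q = chargeL js
  lower : + 1 ≤ℤ β d c′ q
  lower = proj₁ (β-bounds d c′ js wc deg)
  v≡β : + ∣ β d c′ q ∣ ≡ β d c′ q
  v≡β = ℤ.0≤i⇒+∣i∣≡i (ℤ.≤-trans (+≤+ z≤n) lower)
  v≤ : ∣ β d c′ q ∣ ≤ suc d
  v≤ = ℤ.drop‿+≤+ (subst (_≤ℤ + suc d) (sym v≡β) (proj₂ (β-bounds d c′ js wc deg)))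

module _ (d k : ℕ) (s : Sign) (j : ℤ)
         (root-α : ∀ c n → alphaDK d k s c true n ≡ + alpha d c n -ℤ j) where

  alphaTree⇒canonical : ∀ c is → AlphaTree d k s c (node is) → chargeL is ≡ j →
    CanonicalL d c is × misplaced c is ≡ 0
  alphaTree⇒canonical c is ((deg , degs) , fr , (out-eq , od) , acc , nontrivial) q≡j =
    canonical , root-misplaced≡0 d c is canonical deg out-eq′ nontrivial
    where
    canonical : CanonicalL d c is
    canonical = alphaConditions⇒canonical d k s c is degs fr od (accessible⇒rootward is acc)
    out-eq′ : + outL d is ≡ + alpha d c (length is) -ℤ chargeL is
    out-eq′ = trans out-eq (trans (root-α c (length is)) (cong (+ alpha d c (length is) -ℤ_) (sym q≡j)))

  forget-wellCharged : ∀ c o → AlphaTree d k s c o → charge o ≡ j → WellCharged d j c (forgetT o)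
  forget-wellCharged c (node is) α q≡j =
    subst id (sym (DegBounded-forget d true (node is))) (proj₁ α) ,
    (tt , canonical⇒wellCharged d c is canonical m≡0) ,
    trans (chargeL-forget is) q≡j
    where
    canonical : CanonicalL d c is
    canonical = proj₁ (alphaTree⇒canonical c is α q≡j)
    m≡0 : misplaced c is ≡ 0
    m≡0 = proj₂ (alphaTree⇒canonical c is α q≡j)

  build-alphaTree : ∀ c is → WellCharged d j c (node is) → AlphaTree d k s c (build d c (node is))
  build-alphaTree c is (deg , (_ , w) , q≡j) =
    subst id (DegBounded-forget d true (build d c (node is)))
      (subst (DegBounded d true) (sym (forget-build d c (node is))) deg) ,
    canonical⇒fractional d c bis canonical ,
    (out-eq , canonical⇒outdegOK d k s c bis canonical) ,
    rootward⇒accessible bis (canonical⇒rootward d c bis canonical) ,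
    λ trivial → 0≢1+n (trans (sym m≡0) (trivial⇒misplaced≡1 c bis trivial))
    where
    bis : List (Item Or)
    bis = buildL d c is
    canonical : CanonicalL d c bis
    canonical = buildL-canonical d c is w (proj₂ deg)
    m≡0 : misplaced c bis ≡ 0
    m≡0 = trans (misplaced-buildL d c c is) (wellCharged⇒misplaced≡0 c is w)
    out-eq : + outL d bis ≡ alphaDK d k s c true (length bis)
    out-eq = trans (Equivalence.from (x≡y-q⇔x+q≡y (+ outL d bis) (+ alpha d c (length bis)) (chargeL bis))
                                     (balance₀ d c bis canonical m≡0))
                   (trans (cong (+ alpha d c (length bis) -ℤ_) (trans (chargeL-buildL d c is) q≡j))
                          (sym (root-α c (length bis))))

  forget-surjective : ∀ c t → WellCharged d j c t →
    Σ (Tree Or) λ o → forgetT o ≡ t × AlphaTree d k s c o × charge o ≡ j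
  forget-surjective c (node is) wc =
    build d c (node is) , forget-build d c (node is) , build-alphaTree c is wc ,
    trans (chargeL-buildL d c is) (proj₂ (proj₂ wc))

  forget-injective : ∀ c o o′ → AlphaTree d k s c o → charge o ≡ j →
    AlphaTree d k s c o′ → charge o′ ≡ j → forgetT o ≡ forgetT o′ → o ≡ o′
  forget-injective c (node is) (node is′) α q≡j α′ q′≡j eq = begin
    node is                          ≡⟨ built α q≡j ⟩
    build d c (forgetT (node is))    ≡⟨ cong (build d c) eq ⟩
    build d c (forgetT (node is′))   ≡⟨ sym (built α′ q′≡j) ⟩
    node is′                         ∎
    where
    open ≡-Reasoning
    built : ∀ {ks} → AlphaTree d k s c (node ks) → chargeL ks ≡ j →
      node ks ≡ build d c (forgetT (node ks))
    built {ks} α q≡j = cong node (canonical⇒build d c ks (proj₁ (alphaTree⇒canonical c ks α q≡j)))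

  forgetBijection : ForgetBijection d k s j
  forgetBijection = forget-wellCharged , forget-surjective , forget-injective

lemma2p21 : (d k : ℕ) → 1 ≤ k → k ≤ d →
    ForgetBijection d k minus (+ k) × ForgetBijection d k plus (- (+ k))
lemma2p21 d k _ _ =
  forgetBijection d k minus (+ k) (λ _ _ → refl) ,
  forgetBijection d k plus (- + k) (λ c n → cong (+ alpha d c n +ℤ_) (sym (ℤ.neg-involutive (+ k))))
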